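{- For every integer $k\ge 4$, there is a $k$-NL-coloring of the path $P_{\ell(k)-1}$, where $\ell(k)=\frac{k^3-k^2}{2}$.
   Context: A $k$-coloring of a graph $G$ is a partition of $V(G)$ into $k$ independent sets (colors). A coloring $\{S_1,\dots,S_k\}$ is neighbor-locating (a $k$-NL-coloring) if for any two distinct vertices $u,v$ in the same color class, $\{j: N(u)\cap S_j\neq\emptyset\}\neq\{j: N(v)\cap S_j\neq\emptyset\}$. -}

module Defs where

open import Data.Nat using (ℕ; suc; _*_; _∸_; _^_; _/_)
open import Data.Fin using (Fin; toℕ)
open import Data.Product using (Σ; ∃; _×_; _,_)
open import Data.Sum using (_⊎_)
open import Relation.Binary.PropositionalEquality using (_≡_; _≢_)
open import Relation.Nullary using (¬_)
open import Function.Bundles using (_⇔_)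

Graph : ℕ → Set₁
Graph n = Fin n → Fin n → Set

Path : (n : ℕ) → Graph n
Path n i j = (suc (toℕ i) ≡ toℕ j) ⊎ (suc (toℕ j) ≡ toℕ i)

-- A k-coloring: a map to k colors whose classes S_1..S_k are all nonempty
-- (a partition into k parts) and independent (adjacent vertices differ).
IsColoring : {n : ℕ} → Graph n → (k : ℕ) → (Fin n → Fin k) → Set
IsColoring {n} G k c =
  (∀ (j : Fin k) → ∃ λ (v : Fin n) → c v ≡ j) ×
  (∀ (u v : Fin n) → G u v → c u ≢ c v)

SeesColor : {n k : ℕ} → Graph n → (Fin n → Fin k) → Fin n → Fin k → Set
SeesColor {n} G c u j = ∃ λ (w : Fin n) → G u w × c w ≡ j

IsNeighborLocating : {n : ℕ} → Graph n → (k : ℕ) → (Fin n → Fin k) → Set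
IsNeighborLocating {n} G k c =
  ∀ (u v : Fin n) → u ≢ v → c u ≡ c v →
    ¬ (∀ (j : Fin k) → SeesColor G c u j ⇔ SeesColor G c v j)

IsNLColoring : {n : ℕ} → Graph n → (k : ℕ) → (Fin n → Fin k) → Set
IsNLColoring G k c = IsColoring G k c × IsNeighborLocating G k c

-- ℓ(k) = (k^3 - k^2)/2  (k^3 - k^2 is always even).
ℓ : ℕ → ℕ
ℓ k = (k ^ 3 ∸ k ^ 2) / 2

module Submission where

-- A colouring of the path P_n is a colour word x₀ x₁ … x_{n-1}.  The
-- descriptor of vertex i is (x_i , left_i , right_i), its colour and the
-- colours of its two neighbours; at an end of the path the missing neighbour
-- is replaced by a virtual copy of the only real one, which does not change the
-- set of colours the vertex sees.
--
-- Locating criterion (module Locating): if a decoder D, symmetric in the two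
-- neighbour colours, maps every descriptor to the position of its vertex, and
-- adjacent letters differ, the word is neighbor-locating — two vertices of one
-- colour seeing the same colours have descriptors equal up to a swap of the
-- neighbours, hence the same decoded position.
--
-- Construction, for k = 3 + m: the word 2 1 2 0 2 0 1 0 followed by one phase
-- for each new colour M = 3, …, k-1, namely "M 0" and, for y = M-1, …, 1, the
-- block  M y (M y+1 y) (M y+2 y) … (M M-1 y) (M y 0).

open import Defs
open import Data.Nat using (ℕ; zero; suc; _+_; _*_; _∸_; _≤_; _<_; z≤n; s≤s; _⊓_; _⊔_; _^_; _/_)
open import Data.Nat.Properties
open import Data.Nat.DivMod using (m*n/n≡m)
open import Data.Nat.Tactic.RingSolver using (solve-∀)
open import Data.Fin using (Fin; toℕ; fromℕ<)
open import Data.Fin.Properties using (toℕ-fromℕ<; toℕ-injective; toℕ<n)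
open import Data.List using (List; []; _∷_; _++_; length)
open import Data.List.Properties using (length-++; ++-assoc; ++-identityʳ)
open import Data.List.Relation.Unary.Any using (here; there)
open import Data.List.Membership.Propositional using (_∈_)
open import Data.List.Membership.Propositional.Properties using (∈-++⁺ˡ; ∈-++⁺ʳ)
open import Data.Product using (∃; _×_; _,_; proj₁; proj₂)
open import Data.Sum using (_⊎_; inj₁; inj₂)
open import Data.Bool using (if_then_else_)
open import Relation.Nullary using (¬_; Dec; yes; no; does)
open import Relation.Nullary.Decidable using (dec-true; dec-false)
open import Relation.Binary.PropositionalEquality
open import Function.Base using (_∘_)
open import Function.Bundles using (Equivalence)

-- The colour of a vertex together with the colours of its left and right
-- neighbours.
Descriptor : Set
Descriptor = ℕ × ℕ × ℕ

nth : {A : Set} → A → List A → ℕ → A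
nth d [] _ = d
nth d (x ∷ xs) zero = x
nth d (x ∷ xs) (suc i) = nth d xs i

letter : List ℕ → ℕ → ℕ
letter = nth 0

first : ℕ → List ℕ → ℕ
first q [] = q
first q (x ∷ _) = x

final : ℕ → List ℕ → ℕ
final p [] = p
final p (x ∷ xs) = final x xs

descriptors : ℕ → List ℕ → ℕ → List Descriptor
descriptors p [] q = []
descriptors p (x ∷ xs) q = (x , p , first q xs) ∷ descriptors x xs q

length-descriptors : ∀ p xs q → length (descriptors p xs q) ≡ length xs
length-descriptors p [] q = refl
length-descriptors p (x ∷ xs) q = cong suc (length-descriptors x xs q)

first-++ : ∀ q xs ys → first q (xs ++ ys) ≡ first (first q ys) xs
first-++ q [] ys = refl
first-++ q (x ∷ xs) ys = refl

final-++ : ∀ p xs ys → final p (xs ++ ys) ≡ final (final p xs) ys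
final-++ p [] ys = refl
final-++ p (x ∷ xs) ys = final-++ x xs ys

descriptors-++ : ∀ p xs ys q →
  descriptors p (xs ++ ys) q ≡ descriptors p xs (first q ys) ++ descriptors (final p xs) ys q
descriptors-++ p [] ys q = refl
descriptors-++ p (x ∷ xs) ys q =
  cong₂ (λ r L → (x , p , r) ∷ L) (first-++ q xs ys) (descriptors-++ x xs ys q)

descriptors-split : ∀ p xs ys q {r} → final p xs ≡ r →
  descriptors p (xs ++ ys) q ≡ descriptors p xs (first q ys) ++ descriptors r ys q
descriptors-split p xs ys q refl = descriptors-++ p xs ys q

nth-++ˡ : ∀ {A : Set} {d : A} xs ys i → i < length xs → nth d (xs ++ ys) i ≡ nth d xs i
nth-++ˡ (x ∷ xs) ys zero _ = refl
nth-++ˡ (x ∷ xs) ys (suc i) (s≤s i<n) = nth-++ˡ xs ys i i<n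

nth-++ʳ : ∀ {A : Set} {d : A} xs y ys → nth d (xs ++ y ∷ ys) (length xs) ≡ y
nth-++ʳ [] y ys = refl
nth-++ʳ (x ∷ xs) y ys = nth-++ʳ xs y ys

nth-descriptors : ∀ p xs q i → i < length xs →
  nth (0 , 0 , 0) (descriptors p xs q) i ≡ (letter xs i , letter (p ∷ xs) i , letter (xs ++ q ∷ []) (suc i))
nth-descriptors p (x ∷ []) q zero _ = refl
nth-descriptors p (x ∷ y ∷ xs) q zero _ = refl
nth-descriptors p (x ∷ xs) q (suc i) (s≤s i<n) = nth-descriptors x xs q i i<n

∈⇒index : ∀ {j} xs → j ∈ xs → ∃ λ i → i < length xs × letter xs i ≡ j
∈⇒index (x ∷ xs) (here refl) = 0 , s≤s z≤n , refl
∈⇒index (x ∷ xs) (there j∈xs) with ∈⇒index xs j∈xs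
... | i , i<n , eq = suc i , s≤s i<n , eq

same-pair : ∀ {a b a' b' : ℕ} → (a ≡ a' ⊎ a ≡ b') → (b ≡ a' ⊎ b ≡ b') →
  (a' ≡ a ⊎ a' ≡ b) → (b' ≡ a ⊎ b' ≡ b) → (a ≡ a' × b ≡ b') ⊎ (a ≡ b' × b ≡ a')
same-pair (inj₁ e₁) (inj₂ e₂) _ _ = inj₁ (e₁ , e₂)
same-pair (inj₂ e₁) (inj₁ e₂) _ _ = inj₂ (e₁ , e₂)
same-pair (inj₁ refl) (inj₁ refl) _ (inj₁ refl) = inj₁ (refl , refl)
same-pair (inj₁ refl) (inj₁ refl) _ (inj₂ refl) = inj₁ (refl , refl)
same-pair (inj₂ refl) (inj₂ refl) (inj₁ refl) _ = inj₁ (refl , refl)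
same-pair (inj₂ refl) (inj₂ refl) (inj₂ refl) _ = inj₁ (refl , refl)

module Decoding (K : ℕ) (decode : Descriptor → ℕ) where

  Proper : Descriptor → Set
  Proper (b , a , c) = b < K × b ≢ a × b ≢ c

  Decodes : ℕ → ℕ → List Descriptor → Set
  Decodes s e [] = s ≡ e
  Decodes s e (d ∷ L) = decode d ≡ s × Proper d × Decodes (suc s) e L

  decodes-++ : ∀ {s m e} L₁ {L₂} → Decodes s m L₁ → Decodes m e L₂ → Decodes s e (L₁ ++ L₂)
  decodes-++ [] refl h = h
  decodes-++ (d ∷ L₁) (dec , prop , h₁) h₂ = dec , prop , decodes-++ L₁ h₁ h₂

  decodes-cast : ∀ {s s' e e' L} → s ≡ s' → e ≡ e' → Decodes s e L → Decodes s' e' L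
  decodes-cast refl refl h = h

  decodes-length : ∀ {s e} L → Decodes s e L → s + length L ≡ e
  decodes-length [] refl = +-identityʳ _
  decodes-length {s} (d ∷ L) (_ , _ , h) = trans (+-suc s (length L)) (decodes-length L h)

  decodes-nth : ∀ {s e} L i → Decodes s e L → i < length L →
    decode (nth (0 , 0 , 0) L i) ≡ s + i × Proper (nth (0 , 0 , 0) L i)
  decodes-nth (d ∷ L) zero (dec , prop , _) _ = trans dec (sym (+-identityʳ _)) , prop
  decodes-nth {s} (d ∷ L) (suc i) (_ , _ , h) (s≤s i<n) with decodes-nth L i h i<n
  ... | dec , prop = trans dec (sym (+-suc s i)) , prop

-- The word xs has at least two letters: it ends in
-- q r, and p is its second letter, so the virtual neighbours p (left of the
-- first vertex) and q (right of the last one) repeat the colour of the only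
-- real neighbour there.
module Locating (K : ℕ) (decode : Descriptor → ℕ)
  (decode-swap : ∀ b a c → decode (b , a , c) ≡ decode (b , c , a))
  (xs : List ℕ) (p q : ℕ) (zs : List ℕ) (r : ℕ)
  (second-letter : letter xs 1 ≡ p) (ends : xs ≡ zs ++ q ∷ r ∷ [])
  (decodes : Decoding.Decodes K decode 0 (length xs) (descriptors p xs q)) where

  open Decoding K decode

  n : ℕ
  n = length xs

  left right : ℕ → ℕ
  left i = letter (p ∷ xs) i
  right i = letter (xs ++ q ∷ []) (suc i)

  Adjacent : ℕ → ℕ → Set
  Adjacent i w = (suc i ≡ w) ⊎ (suc w ≡ i)

  decodes-at : ∀ i → i < n → decode (letter xs i , left i , right i) ≡ i × Proper (letter xs i , left i , right i)
  decodes-at i i<n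
    with decodes-nth (descriptors p xs q) i decodes (subst (i <_) (sym (length-descriptors p xs q)) i<n)
  ... | dec , prop rewrite nth-descriptors p xs q i i<n = dec , prop

  colour : Fin n → Fin K
  colour u = fromℕ< (proj₁ (proj₂ (decodes-at (toℕ u) (toℕ<n u))))

  toℕ-colour : ∀ u → toℕ (colour u) ≡ letter xs (toℕ u)
  toℕ-colour u = toℕ-fromℕ< _

  length-ends : n ≡ suc (suc (length zs))
  length-ends = trans (cong length ends) (trans (length-++ zs) (+-comm (length zs) 2))

  right-inside : ∀ i → suc i < n → right i ≡ letter xs (suc i)
  right-inside i si<n = nth-++ˡ xs (q ∷ []) (suc i) si<n

  left-realised : ∀ i → i < n → ∃ λ w → w < n × Adjacent i w × letter xs w ≡ left i
  left-realised zero _ = 1 , subst (1 <_) (sym length-ends) (s≤s (s≤s z≤n)) , inj₁ refl , second-letter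
  left-realised (suc i) si<n = i , <-trans (n<1+n i) si<n , inj₂ refl , refl

  right-realised : ∀ i → i < n → ∃ λ w → w < n × Adjacent i w × letter xs w ≡ right i
  right-realised i i<n with suc i <? n
  ... | yes si<n = suc i , si<n , inj₁ refl , sym (right-inside i si<n)
  ... | no si≮n = length zs , zs<n , inj₂ (suc-injective (sym (trans last length-ends))) , realises
    where
    last : suc i ≡ n
    last = ≤-antisym i<n (≮⇒≥ si≮n)
    zs<n : length zs < n
    zs<n = subst (length zs <_) (sym length-ends) (≤-trans (n<1+n _) (n≤1+n _))
    realises : letter xs (length zs) ≡ right i
    realises = begin
      letter xs (length zs)                ≡⟨ cong (λ ws → letter ws (length zs)) ends ⟩
      letter (zs ++ q ∷ r ∷ []) (length zs) ≡⟨ nth-++ʳ zs q (r ∷ []) ⟩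
      q                                    ≡⟨ sym (nth-++ʳ xs q []) ⟩
      letter (xs ++ q ∷ []) n              ≡⟨ cong (letter (xs ++ q ∷ [])) (sym last) ⟩
      right i                              ∎
      where open ≡-Reasoning

  Sees : Fin n → Fin K → Set
  Sees = SeesColor (Path n) colour

  sees⇒side : ∀ u j → Sees u j → toℕ j ≡ left (toℕ u) ⊎ toℕ j ≡ right (toℕ u)
  sees⇒side u j (w , inj₁ sw≡u , refl) = inj₂ (trans (toℕ-colour w)
    (trans (cong (letter xs) (sym sw≡u)) (sym (right-inside (toℕ u) (subst (_< n) (sym sw≡u) (toℕ<n w))))))
  sees⇒side u j (w , inj₂ su≡w , refl) = inj₁ (trans (toℕ-colour w) (cong (letter (p ∷ xs)) su≡w))

  adjacent⇒sees : ∀ u w (w<n : w < n) → Adjacent (toℕ u) w → Sees u (colour (fromℕ< w<n))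
  adjacent⇒sees u w w<n (inj₁ e) = fromℕ< w<n , inj₁ (trans e (sym (toℕ-fromℕ< w<n))) , refl
  adjacent⇒sees u w w<n (inj₂ e) = fromℕ< w<n , inj₂ (trans (cong suc (toℕ-fromℕ< w<n)) e) , refl

  toℕ-colour-fromℕ< : ∀ {w} (w<n : w < n) → toℕ (colour (fromℕ< w<n)) ≡ letter xs w
  toℕ-colour-fromℕ< w<n = trans (toℕ-colour (fromℕ< w<n)) (cong (letter xs) (toℕ-fromℕ< w<n))

  side-included : ∀ u v → (∀ j → Sees u j → Sees v j) → ∀ a →
    (∃ λ w → w < n × Adjacent (toℕ u) w × letter xs w ≡ a) → a ≡ left (toℕ v) ⊎ a ≡ right (toℕ v)
  side-included u v incl a (w , w<n , adj , refl)
    with sees⇒side v _ (incl _ (adjacent⇒sees u w w<n adj))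
  ... | inj₁ e = inj₁ (trans (sym (toℕ-colour-fromℕ< w<n)) e)
  ... | inj₂ e = inj₂ (trans (sym (toℕ-colour-fromℕ< w<n)) e)

  surjective : (∀ j → j < K → j ∈ xs) → ∀ (j : Fin K) → ∃ λ v → colour v ≡ j
  surjective occurs j with ∈⇒index xs (occurs (toℕ j) (toℕ<n j))
  ... | i , i<n , eq = fromℕ< i<n , toℕ-injective (trans (toℕ-colour-fromℕ< i<n) eq)

  independent : ∀ u v → Path n u v → colour u ≢ colour v
  independent u v (inj₁ su≡v) eq = proj₂ (proj₂ (proj₂ (decodes-at (toℕ u) (toℕ<n u))))
    (trans (sym (toℕ-colour u)) (trans (cong toℕ eq) (trans (toℕ-colour v)
      (trans (cong (letter xs) (sym su≡v)) (sym (right-inside (toℕ u) (subst (_< n) (sym su≡v) (toℕ<n v))))))))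
  independent u v (inj₂ sv≡u) eq = proj₁ (proj₂ (proj₂ (decodes-at (toℕ u) (toℕ<n u))))
    (trans (sym (toℕ-colour u)) (trans (cong toℕ eq) (trans (toℕ-colour v) (cong (letter (p ∷ xs)) sv≡u))))

  -- Equal colours and equal seen colour sets force equal descriptors up to a
  -- swap of the neighbours, hence equal decoded positions.
  locating : IsNeighborLocating (Path n) K colour
  locating u v u≢v same-colour same-sets = u≢v (toℕ-injective (begin
    toℕ u                                         ≡⟨ sym (proj₁ (decodes-at i (toℕ<n u))) ⟩
    decode (letter xs i , left i , right i)       ≡⟨ same-descriptor ⟩
    decode (letter xs i' , left i' , right i')    ≡⟨ proj₁ (decodes-at i' (toℕ<n v)) ⟩
    toℕ v                                         ∎))
    where
    open ≡-Reasoning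
    i i' : ℕ
    i = toℕ u
    i' = toℕ v
    u⊆v : ∀ j → Sees u j → Sees v j
    u⊆v j = Equivalence.to (same-sets j)
    v⊆u : ∀ j → Sees v j → Sees u j
    v⊆u j = Equivalence.from (same-sets j)
    same-letter : letter xs i ≡ letter xs i'
    same-letter = trans (sym (toℕ-colour u)) (trans (cong toℕ same-colour) (toℕ-colour v))
    same-descriptor : decode (letter xs i , left i , right i) ≡ decode (letter xs i' , left i' , right i')
    same-descriptor with same-pair
      (side-included u v u⊆v _ (left-realised i (toℕ<n u))) (side-included u v u⊆v _ (right-realised i (toℕ<n u)))
      (side-included v u v⊆u _ (left-realised i' (toℕ<n v))) (side-included v u v⊆u _ (right-realised i' (toℕ<n v)))
    ... | inj₁ (eₗ , eᵣ) rewrite same-letter | eₗ | eᵣ = refl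
    ... | inj₂ (eₗ , eᵣ) rewrite same-letter | eₗ | eᵣ = decode-swap _ _ _

  nl-colouring : (∀ j → j < K → j ∈ xs) → ∃ λ (c : Fin n → Fin K) → IsNLColoring (Path n) K c
  nl-colouring occurs = colour , (surjective occurs , independent) , locating

-- Phase M (the colour M ≥ 3 enters) starts at
-- phaseStart M and consists of "M 0" followed by one block for each
-- y = M-1,…,1; the block with index j = M-1-y starts blockOffset j after the
-- phase start and is "M y" followed by j+1 triples of letters, the i-th of
-- which starts at tripleStart M y i.
blockOffset : ℕ → ℕ
blockOffset zero = 2
blockOffset (suc j) = blockOffset j + (3 * j + 5)

wordLength : ℕ → ℕ
wordLength zero = 8
wordLength (suc m) = wordLength m + blockOffset (2 + m)

phaseStart : ℕ → ℕ
phaseStart M = wordLength (M ∸ 3)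

blockStart : ℕ → ℕ → ℕ
blockStart M y = phaseStart M + blockOffset (M ∸ suc y)

tripleStart : ℕ → ℕ → ℕ → ℕ
tripleStart M y i = blockStart M y + (2 + 3 * i)

-- Descriptors with colours ≤ 2 only occur in the initial word
-- 2 1 2 0 2 0 1 0; its last vertex has descriptor (0,1,1) and, if no phase
-- follows, is the last vertex N of the path.  Otherwise the largest colour M
-- names the phase: centre handles b = M, side handles hi = M.
initialTable : ℕ → ℕ → ℕ → ℕ → ℕ
initialTable N 2 1 1 = 0
initialTable N 1 2 2 = 1
initialTable N 2 0 1 = 2
initialTable N 0 2 2 = 3
initialTable N 2 0 0 = 4
initialTable N 0 1 2 = 5
initialTable N 1 0 0 = 6
initialTable N 0 1 1 = N
initialTable N _ _ _ = 0

-- Positions of the vertices of colour M in phase M, by neighbour colours: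
-- the leading M (0,0), the first letter of block y (0,y), the first letter of
-- its i-th triple (y,y+1+i) and of its closing triple (y,y).
centre : ℕ → ℕ → ℕ → ℕ
centre M lo hi =
  if does (lo ≟ 0) then (if does (hi ≟ 0) then phaseStart M else blockStart M hi)
  else if does (lo ≟ hi) then tripleStart M lo (M ∸ suc lo)
  else tripleStart M lo (hi ∸ suc lo)

-- Positions of the vertices of colour b < M whose larger neighbour colour is
-- M: the 0 after the leading M (M,M), the second letter of block y (M,M), the
-- last vertex of the previous phase (1,M), the middle (y,M) and last
-- (y+1+i,M) letters of the triples of block y, and the last two letters y
-- (0,M) and 0 (y,M) of block y.
side : ℕ → ℕ → ℕ → ℕ
side b lo M =
  if does (lo ≟ M) then (if does (b ≟ 0) then suc (phaseStart M) else suc (blockStart M b))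
  else if does (b ≟ 0) then
    (if does (lo ≟ 1) then phaseStart M ∸ 1 else suc (suc (tripleStart M lo (M ∸ suc lo))))
  else if does (lo ≟ 0) then suc (tripleStart M b (M ∸ suc b))
  else if does (lo <? b) then suc (tripleStart M lo (b ∸ suc lo))
  else suc (suc (tripleStart M b (lo ∸ suc b)))

decode₀ : ℕ → ℕ → ℕ → ℕ → ℕ
decode₀ N b lo hi =
  if does (b ⊔ hi ≤? 2) then initialTable N b lo hi
  else if does (hi <? b) then centre b lo hi
  else side b lo hi

decode : ℕ → Descriptor → ℕ
decode N (b , a , c) = decode₀ N b (a ⊓ c) (a ⊔ c)

decode-swap : ∀ N b a c → decode N (b , a , c) ≡ decode N (b , c , a)
decode-swap N b a c = cong₂ (decode₀ N b) (⊓-comm a c) (⊔-comm a c)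

decode-ordered : ∀ N b {a c} → a ≤ c → decode N (b , a , c) ≡ decode₀ N b a c
decode-ordered N b a≤c = cong₂ (decode₀ N b) (m≤n⇒m⊓n≡m a≤c) (m≤n⇒m⊔n≡n a≤c)

decode-reversed : ∀ N b {a c} → c ≤ a → decode N (b , a , c) ≡ decode₀ N b c a
decode-reversed N b {a} {c} c≤a = trans (decode-swap N b a c) (decode-ordered N b c≤a)

if-holds : ∀ {P : Set} (P? : Dec P) {x y : ℕ} → P → (if does P? then x else y) ≡ x
if-holds P? p rewrite dec-true P? p = refl

if-fails : ∀ {P : Set} (P? : Dec P) {x y : ℕ} → ¬ P → (if does P? then x else y) ≡ y
if-fails P? ¬p rewrite dec-false P? ¬p = refl

beyond-initial : ∀ {M x} → 3 ≤ M → M ≤ x → ¬ x ≤ 2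
beyond-initial 3≤M M≤x x≤2 = <-irrefl refl (≤-trans 3≤M (≤-trans M≤x x≤2))

decode-centre : ∀ N b lo hi → ¬ b ⊔ hi ≤ 2 → hi < b → decode₀ N b lo hi ≡ centre b lo hi
decode-centre N b lo hi large hi<b =
  trans (if-fails (b ⊔ hi ≤? 2) large) (if-holds (hi <? b) hi<b)

decode-side : ∀ N b lo hi → ¬ b ⊔ hi ≤ 2 → ¬ hi < b → decode₀ N b lo hi ≡ side b lo hi
decode-side N b lo hi large hi≮b =
  trans (if-fails (b ⊔ hi ≤? 2) large) (if-fails (hi <? b) hi≮b)

centre-0-0 : ∀ M → centre M 0 0 ≡ phaseStart M
centre-0-0 M = refl

centre-0-y : ∀ M {y} → y ≢ 0 → centre M 0 y ≡ blockStart M y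
centre-0-y M {y} y≢0 = if-fails (y ≟ 0) y≢0

centre-y-y : ∀ M {y} → y ≢ 0 → centre M y y ≡ tripleStart M y (M ∸ suc y)
centre-y-y M {y} y≢0 = trans (if-fails (y ≟ 0) y≢0) (if-holds (y ≟ y) refl)

centre-y-w : ∀ M {y w} → y ≢ 0 → y ≢ w → centre M y w ≡ tripleStart M y (w ∸ suc y)
centre-y-w M {y} {w} y≢0 y≢w = trans (if-fails (y ≟ 0) y≢0) (if-fails (y ≟ w) y≢w)

side-0-M-M : ∀ M → side 0 M M ≡ suc (phaseStart M)
side-0-M-M M = if-holds (M ≟ M) refl

side-y-M-M : ∀ M {y} → y ≢ 0 → side y M M ≡ suc (blockStart M y)
side-y-M-M M {y} y≢0 = trans (if-holds (M ≟ M) refl) (if-fails (y ≟ 0) y≢0)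

side-0-1-M : ∀ M → 1 ≢ M → side 0 1 M ≡ phaseStart M ∸ 1
side-0-1-M M 1≢M = if-fails (1 ≟ M) 1≢M

side-0-y-M : ∀ M {y} → y ≢ M → y ≢ 1 → side 0 y M ≡ suc (suc (tripleStart M y (M ∸ suc y)))
side-0-y-M M {y} y≢M y≢1 = trans (if-fails (y ≟ M) y≢M) (if-fails (y ≟ 1) y≢1)

side-y-0-M : ∀ M {y} → 0 ≢ M → y ≢ 0 → side y 0 M ≡ suc (tripleStart M y (M ∸ suc y))
side-y-0-M M {y} 0≢M y≢0 = trans (if-fails (0 ≟ M) 0≢M) (if-fails (y ≟ 0) y≢0)

side-w-y-M : ∀ M {y w} → y ≢ M → w ≢ 0 → y ≢ 0 → y < w → side w y M ≡ suc (tripleStart M y (w ∸ suc y))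
side-w-y-M M {y} {w} y≢M w≢0 y≢0 y<w =
  trans (if-fails (y ≟ M) y≢M) (trans (if-fails (w ≟ 0) w≢0) (trans (if-fails (y ≟ 0) y≢0) (if-holds (y <? w) y<w)))

side-y-w-M : ∀ M {y w} → w ≢ M → y ≢ 0 → w ≢ 0 → ¬ w < y → side y w M ≡ suc (suc (tripleStart M y (w ∸ suc y)))
side-y-w-M M {y} {w} w≢M y≢0 w≢0 w≮y =
  trans (if-fails (w ≟ M) w≢M) (trans (if-fails (y ≟ 0) y≢0) (trans (if-fails (w ≟ 0) w≢0) (if-fails (w <? y) w≮y)))

triples : ℕ → ℕ → ℕ → ℕ → List ℕ
triples M y i zero = []
triples M y i (suc r) = M ∷ y + suc i ∷ y ∷ triples M y (suc i) r

-- Block y of phase M, with index j = M-1-y: "M y", the j triples, and the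
-- closing triple "M y 0".
block : ℕ → ℕ → ℕ → List ℕ
block M y j = M ∷ y ∷ (triples M y 0 j ++ M ∷ y ∷ 0 ∷ [])

blocks : ℕ → ℕ → ℕ → List ℕ
blocks M zero j = []
blocks M (suc y) j = block M (suc y) j ++ blocks M y (suc j)

phase : ℕ → List ℕ
phase M = M ∷ 0 ∷ blocks M (M ∸ 1) 0

phases : ℕ → List ℕ
phases zero = []
phases (suc m) = phases m ++ phase (3 + m)

-- The colour word for k = 3 + m colours.
word : ℕ → List ℕ
word m = 2 ∷ 1 ∷ 2 ∷ 0 ∷ 2 ∷ 0 ∷ 1 ∷ 0 ∷ phases m

first-triples : ∀ M y i r → first M (triples M y i r) ≡ M
first-triples M y i zero = refl
first-triples M y i (suc r) = refl

final-triples : ∀ M y i r → final y (triples M y i r) ≡ y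
final-triples M y i zero = refl
final-triples M y i (suc r) = final-triples M y (suc i) r

final-block : ∀ p M y j → final p (block M y j) ≡ 0
final-block p M y j = final-++ y (triples M y 0 j) (M ∷ y ∷ 0 ∷ [])

final-blocks : ∀ M y j → final 0 (blocks M y j) ≡ 0
final-blocks M zero j = refl
final-blocks M (suc y) j = begin
  final 0 (block M (suc y) j ++ blocks M y (suc j))         ≡⟨ final-++ 0 (block M (suc y) j) _ ⟩
  final (final 0 (block M (suc y) j)) (blocks M y (suc j))  ≡⟨ cong (λ p → final p (blocks M y (suc j)))
                                                                 (final-block 0 M (suc y) j) ⟩
  final 0 (blocks M y (suc j))                              ≡⟨ final-blocks M y (suc j) ⟩
  0                                                         ∎
  where open ≡-Reasoning

final-word : ∀ m → final 1 (word m) ≡ 0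
final-word zero = refl
final-word (suc m) = trans (final-++ 1 (word m) (phase (3 + m))) (final-blocks (3 + m) (2 + m) 0)

prefix-suffix : ∀ (as : List ℕ) {bs t} → (∃ λ cs → bs ≡ cs ++ t) → ∃ λ cs → as ++ bs ≡ cs ++ t
prefix-suffix as {t = t} (cs , refl) = as ++ cs , sym (++-assoc as cs t)

blocks-end : ∀ M y j → ∃ λ cs → blocks M (suc y) j ≡ cs ++ 1 ∷ 0 ∷ []
blocks-end M zero j = M ∷ 1 ∷ (triples M 1 0 j ++ M ∷ []) ,
  trans (++-identityʳ _) (cong (λ ws → M ∷ 1 ∷ ws) (sym (++-assoc (triples M 1 0 j) (M ∷ []) (1 ∷ 0 ∷ []))))
blocks-end M (suc y) j = prefix-suffix (block M (suc (suc y)) j) (blocks-end M y (suc j))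

word-end : ∀ m → ∃ λ cs → word m ≡ cs ++ 1 ∷ 0 ∷ []
word-end zero = 2 ∷ 1 ∷ 2 ∷ 0 ∷ 2 ∷ 0 ∷ [] , refl
word-end (suc m) = prefix-suffix (word m) (prefix-suffix (3 + m ∷ 0 ∷ []) (blocks-end (3 + m) (1 + m) 0))

colours-occur : ∀ m j → j < 3 + m → j ∈ word m
colours-occur zero 0 _ = there (there (there (here refl)))
colours-occur zero 1 _ = there (here refl)
colours-occur zero 2 _ = here refl
colours-occur zero (suc (suc (suc j))) (s≤s (s≤s (s≤s ())))
colours-occur (suc m) j j<k with j <? 3 + m
... | yes j<k' = ∈-++⁺ˡ (colours-occur m j j<k')
... | no j≮k' = ∈-++⁺ʳ (word m) (here (≤-antisym (≤-pred j<k) (≮⇒≥ j≮k')))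

tripleStart-suc : ∀ M y i → tripleStart M y (suc i) ≡ suc (suc (suc (tripleStart M y i)))
tripleStart-suc M y i = lemma (blockStart M y) i
  where
  lemma : ∀ o i → o + (2 + 3 * suc i) ≡ suc (suc (suc (o + (2 + 3 * i))))
  lemma = solve-∀

tripleStart-zero : ∀ M y → tripleStart M y 0 ≡ suc (suc (blockStart M y))
tripleStart-zero M y = +-comm (blockStart M y) 2

next-blockOffset : ∀ s j → suc (suc (suc (s + blockOffset j + (2 + 3 * j)))) ≡ s + blockOffset (suc j)
next-blockOffset s j = lemma s (blockOffset j) j
  where
  lemma : ∀ s b j → suc (suc (suc (s + b + (2 + 3 * j)))) ≡ s + (b + (3 * j + 5))
  lemma = solve-∀

sub-suc : ∀ y i → y + suc i ∸ suc y ≡ i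
sub-suc y i = trans (cong (_∸ suc y) (+-suc y i)) (m+n∸m≡n y i)

-- Decoding of the word for k colours; N is the position of its last vertex.
module Verification (N K : ℕ) where
  open Decoding K (decode N) public

  module Block (M y j : ℕ) (y+j : y + suc j ≡ M) (1≤y : 1 ≤ y) (3≤M : 3 ≤ M) (M<K : M < K) where

    index : M ∸ suc y ≡ j
    index = trans (cong (_∸ suc y) (sym y+j)) (sub-suc y j)

    y<M : y < M
    y<M = subst (y <_) y+j (m<m+n y (s≤s z≤n))

    y<K : y < K
    y<K = <-trans y<M M<K

    y≢0 : y ≢ 0
    y≢0 = >⇒≢ 1≤y

    0<M : 0 < M
    0<M = ≤-trans (s≤s z≤n) 3≤M

    y<w : ∀ i → y < y + suc i
    y<w i = m<m+n y (s≤s z≤n)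

    w<M : ∀ i → i < j → y + suc i < M
    w<M i i<j = subst (y + suc i <_) y+j (+-monoʳ-< y (s≤s i<j))

    large : ∀ {x} → M ≤ x → ¬ x ≤ 2
    large = beyond-initial 3≤M

    decode-M-0-y : decode N (M , 0 , y) ≡ blockStart M y
    decode-M-0-y = trans (decode-ordered N M z≤n)
      (trans (decode-centre N M 0 y (large (m≤m⊔n M y)) y<M) (centre-0-y M y≢0))

    decode-y-M-M : decode N (y , M , M) ≡ suc (blockStart M y)
    decode-y-M-M = trans (decode-ordered N y ≤-refl)
      (trans (decode-side N y M M (large (m≤n⊔m y M)) (<⇒≱ y<M ∘ <⇒≤)) (side-y-M-M M y≢0))

    decode-triple₀ : ∀ i → i < j → decode N (M , y , y + suc i) ≡ tripleStart M y i
    decode-triple₀ i i<j = trans (decode-ordered N M (<⇒≤ (y<w i)))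
      (trans (decode-centre N M y (y + suc i) (large (m≤m⊔n M (y + suc i))) (w<M i i<j))
        (trans (centre-y-w M y≢0 (<⇒≢ (y<w i))) (cong (tripleStart M y) (sub-suc y i))))

    decode-triple₁ : ∀ i → i < j → decode N (y + suc i , M , y) ≡ suc (tripleStart M y i)
    decode-triple₁ i i<j = trans (decode-reversed N (y + suc i) (<⇒≤ y<M))
      (trans (decode-side N (y + suc i) y M (large (m≤n⊔m (y + suc i) M)) (<⇒≱ (w<M i i<j) ∘ <⇒≤))
        (trans (side-w-y-M M (<⇒≢ y<M) (>⇒≢ (≤-trans (s≤s z≤n) (y<w i))) y≢0 (y<w i))
          (cong (suc ∘ tripleStart M y) (sub-suc y i))))

    decode-triple₂ : ∀ i → i < j → decode N (y , y + suc i , M) ≡ suc (suc (tripleStart M y i))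
    decode-triple₂ i i<j = trans (decode-ordered N y (<⇒≤ (w<M i i<j)))
      (trans (decode-side N y (y + suc i) M (large (m≤n⊔m y M)) (<⇒≱ y<M ∘ <⇒≤))
        (trans (side-y-w-M M (<⇒≢ (w<M i i<j)) y≢0 (>⇒≢ (≤-trans (s≤s z≤n) (y<w i))) (<⇒≱ (y<w i) ∘ <⇒≤))
          (cong (suc ∘ suc ∘ tripleStart M y) (sub-suc y i))))

    decode-closing₀ : decode N (M , y , y) ≡ tripleStart M y j
    decode-closing₀ = trans (decode-ordered N M ≤-refl)
      (trans (decode-centre N M y y (large (m≤m⊔n M y)) y<M) (trans (centre-y-y M y≢0) (cong (tripleStart M y) index)))

    decode-closing₁ : decode N (y , M , 0) ≡ suc (tripleStart M y j)
    decode-closing₁ = trans (decode-reversed N y z≤n)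
      (trans (decode-side N y 0 M (large (m≤n⊔m y M)) (<⇒≱ y<M ∘ <⇒≤))
        (trans (side-y-0-M M (<⇒≢ 0<M) y≢0) (cong (suc ∘ tripleStart M y) index)))

    decode-closing₂ : 2 ≤ y → decode N (0 , y , M) ≡ suc (suc (tripleStart M y j))
    decode-closing₂ 2≤y = trans (decode-ordered N 0 (<⇒≤ y<M))
      (trans (decode-side N 0 y M (large (m≤n⊔m 0 M)) (λ ()))
        (trans (side-0-y-M M (<⇒≢ y<M) (>⇒≢ 2≤y)) (cong (suc ∘ suc ∘ tripleStart M y) index)))

    triples-decode : ∀ r i → i + r ≤ j →
      Decodes (tripleStart M y i) (tripleStart M y (i + r)) (descriptors y (triples M y i r) M)
    triples-decode zero i _ = cong (tripleStart M y) (sym (+-identityʳ i))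
    triples-decode (suc r) i i+r<j rewrite first-triples M y (suc i) r =
      decode-triple₀ i i<j , (M<K , >⇒≢ y<M , >⇒≢ (w<M i i<j)) ,
      decode-triple₁ i i<j , (<-trans (w<M i i<j) M<K , <⇒≢ (w<M i i<j) , >⇒≢ (y<w i)) ,
      decode-triple₂ i i<j , (y<K , <⇒≢ (y<w i) , <⇒≢ y<M) ,
      decodes-cast (tripleStart-suc M y i) (cong (tripleStart M y) (sym (+-suc i r)))
        (triples-decode r (suc i) (subst (_≤ j) (+-suc i r) i+r<j))
      where
      i<j : i < j
      i<j = ≤-trans (m<m+n i (s≤s z≤n)) i+r<j

    block-decodes : ∀ next → decode N (0 , y , next) ≡ suc (suc (tripleStart M y j)) → Proper (0 , y , next) →
      Decodes (blockStart M y) (suc (suc (suc (tripleStart M y j)))) (descriptors 0 (block M y j) next)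
    block-decodes next decode-last proper-last
      rewrite first-++ next (triples M y 0 j) (M ∷ y ∷ 0 ∷ []) | first-triples M y 0 j
            | descriptors-++ y (triples M y 0 j) (M ∷ y ∷ 0 ∷ []) next | final-triples M y 0 j =
      decode-M-0-y , (M<K , >⇒≢ 0<M , >⇒≢ y<M) ,
      decode-y-M-M , (y<K , <⇒≢ y<M , <⇒≢ y<M) ,
      decodes-++ (descriptors y (triples M y 0 j) M)
        (decodes-cast (tripleStart-zero M y) refl (triples-decode j 0 ≤-refl)) closing
      where
      closing : Decodes (tripleStart M y j) (suc (suc (suc (tripleStart M y j))))
        ((M , y , y) ∷ (y , M , 0) ∷ (0 , y , next) ∷ [])
      closing = decode-closing₀ , (M<K , >⇒≢ y<M , >⇒≢ y<M) ,
        decode-closing₁ , (y<K , <⇒≢ y<M , y≢0) , decode-last , proper-last , refl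

    block-start : blockStart M y ≡ phaseStart M + blockOffset j
    block-start = cong (λ i → phaseStart M + blockOffset i) index

    block-end : suc (suc (suc (tripleStart M y j))) ≡ phaseStart M + blockOffset (suc j)
    block-end = trans (cong (λ o → suc (suc (suc (o + (2 + 3 * j))))) block-start)
      (next-blockOffset (phaseStart M) j)

  blocks-decode : ∀ M → 3 ≤ M → M < K → ∀ y j n → y + suc j ≡ M →
    decode N (0 , 1 , n) ≡ phaseStart M + blockOffset (M ∸ 1) ∸ 1 → Proper (0 , 1 , n) →
    Decodes (phaseStart M + blockOffset j) (phaseStart M + blockOffset (M ∸ 1)) (descriptors 0 (blocks M y j) n)
  blocks-decode M 3≤M M<K zero j n y+j _ _ = cong (λ x → phaseStart M + blockOffset (x ∸ 1)) y+j
  blocks-decode M 3≤M M<K (suc zero) j n y+j decode-last proper-last =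
    subst (Decodes _ _) (cong (λ ws → descriptors 0 ws n) (sym (++-identityʳ (block M 1 j))))
      (decodes-cast block-start (trans block-end phase-end)
        (block-decodes n (trans decode-last (cong (_∸ 1) (sym (trans block-end phase-end)))) proper-last))
    where
    open Block M 1 j y+j ≤-refl 3≤M M<K
    phase-end : phaseStart M + blockOffset (suc j) ≡ phaseStart M + blockOffset (M ∸ 1)
    phase-end = cong (λ x → phaseStart M + blockOffset (x ∸ 1)) y+j
  blocks-decode M 3≤M M<K (suc (suc y)) j n y+j decode-last proper-last =
    subst (Decodes _ _) (sym (descriptors-split 0 (block M (suc (suc y)) j) _ n (final-block 0 M (suc (suc y)) j)))
      (decodes-++ (descriptors 0 (block M (suc (suc y)) j) M)
        (decodes-cast block-start block-end
          (block-decodes M (decode-closing₂ (s≤s (s≤s z≤n))) (<-trans 0<M M<K , (λ ()) , <⇒≢ 0<M)))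
        (blocks-decode M 3≤M M<K (suc y) (suc j) n (trans (+-suc (suc y) (suc j)) y+j) decode-last proper-last))
    where open Block M (suc (suc y)) j y+j (s≤s z≤n) 3≤M M<K

  phase-decodes : ∀ m n → 3 + m < K →
    decode N (0 , 1 , n) ≡ wordLength (suc m) ∸ 1 → Proper (0 , 1 , n) →
    Decodes (wordLength m) (wordLength (suc m)) (descriptors 0 (phase (3 + m)) n)
  phase-decodes m n M<K decode-last proper-last =
    decode-M-0-0 , (M<K , >⇒≢ 0<M , >⇒≢ 0<M) ,
    decode-0-M-M , (<-trans 0<M M<K , <⇒≢ 0<M , <⇒≢ 0<M) ,
    decodes-cast (+-comm (wordLength m) 2) refl
      (blocks-decode M (s≤s (s≤s (s≤s z≤n))) M<K (2 + m) 0 n (+-comm (2 + m) 1) decode-last proper-last)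
    where
    M : ℕ
    M = 3 + m
    0<M : 0 < M
    0<M = s≤s z≤n
    large : ¬ M ≤ 2
    large = beyond-initial (s≤s (s≤s (s≤s z≤n))) ≤-refl
    decode-M-0-0 : decode N (M , 0 , 0) ≡ wordLength m
    decode-M-0-0 = trans (decode-centre N M 0 0 large 0<M) (centre-0-0 M)
    decode-0-M-M : decode N (0 , M , M) ≡ suc (wordLength m)
    decode-0-M-M = trans (decode-ordered N 0 {M} ≤-refl) (trans (decode-side N 0 M M large (λ ())) (side-0-M-M M))

  word-decodes : ∀ m n → 3 + m ≤ K → decode N (0 , 1 , n) ≡ wordLength m ∸ 1 → Proper (0 , 1 , n) →
    Decodes 0 (wordLength m) (descriptors 1 (word m) n)
  word-decodes zero n 3≤K decode-last proper-last =
    refl , (2<K , (λ ()) , (λ ())) ,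
    refl , (1<K , (λ ()) , (λ ())) ,
    refl , (2<K , (λ ()) , (λ ())) ,
    refl , (0<K , (λ ()) , (λ ())) ,
    refl , (2<K , (λ ()) , (λ ())) ,
    refl , (0<K , (λ ()) , (λ ())) ,
    refl , (1<K , (λ ()) , (λ ())) ,
    decode-last , proper-last , refl
    where
    2<K : 2 < K
    2<K = 3≤K
    1<K : 1 < K
    1<K = <-trans (s≤s (s≤s z≤n)) 3≤K
    0<K : 0 < K
    0<K = <-trans (s≤s z≤n) 1<K
  word-decodes (suc m) n 4≤K decode-last proper-last =
    subst (Decodes _ _) (sym (descriptors-split 1 (word m) (phase (3 + m)) n (final-word m)))
      (decodes-++ (descriptors 1 (word m) (3 + m))
        (word-decodes m (3 + m) (≤-trans (n≤1+n _) 4≤K) decode-0-1-M (<-trans (s≤s z≤n) 4≤K , (λ ()) , (λ ())))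
        (phase-decodes m n 4≤K decode-last proper-last))
    where
    decode-0-1-M : decode N (0 , 1 , 3 + m) ≡ wordLength m ∸ 1
    decode-0-1-M = trans (decode-side N 0 1 (3 + m) (beyond-initial (s≤s (s≤s (s≤s z≤n))) ≤-refl) (λ ()))
      (side-0-1-M (3 + m) (λ ()))

-- Counting: 2·blockOffset j = 3j² + 7j + 4, so that the phases add up to
-- k³ = k² + 2·(|word| + 1), i.e. |word| = ℓ(k) - 1.
twice-blockOffset : ∀ j → 2 * blockOffset j ≡ 3 * j * j + 7 * j + 4
twice-blockOffset zero = refl
twice-blockOffset (suc j) = begin
  2 * (blockOffset j + (3 * j + 5))         ≡⟨ *-distribˡ-+ 2 (blockOffset j) _ ⟩
  2 * blockOffset j + 2 * (3 * j + 5)       ≡⟨ cong (_+ 2 * (3 * j + 5)) (twice-blockOffset j) ⟩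
  3 * j * j + 7 * j + 4 + 2 * (3 * j + 5)   ≡⟨ expand j ⟩
  3 * suc j * suc j + 7 * suc j + 4         ∎
  where
  open ≡-Reasoning
  expand : ∀ j → 3 * j * j + 7 * j + 4 + 2 * (3 * j + 5) ≡ 3 * suc j * suc j + 7 * suc j + 4
  expand = solve-∀

cube-identity : ∀ m → (3 + m) ^ 3 ≡ (3 + m) ^ 2 + 2 * (wordLength m + 1)
cube-identity zero = refl
cube-identity (suc m) = +-cancelˡ-≡ ((3 + m) ^ 2) _ _ (begin
  (3 + m) ^ 2 + (4 + m) ^ 3
    ≡⟨ difference m ⟩
  (4 + m) ^ 2 + (3 * (2 + m) * (2 + m) + 7 * (2 + m) + 4) + (3 + m) ^ 3
    ≡⟨ cong₂ (λ b c → (4 + m) ^ 2 + b + c) (sym (twice-blockOffset (2 + m))) (cube-identity m) ⟩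
  (4 + m) ^ 2 + 2 * blockOffset (2 + m) + ((3 + m) ^ 2 + 2 * (wordLength m + 1))
    ≡⟨ regroup m (wordLength m) (blockOffset (2 + m)) ⟩
  (3 + m) ^ 2 + ((4 + m) ^ 2 + 2 * (wordLength m + blockOffset (2 + m) + 1)) ∎)
  where
  open ≡-Reasoning
  difference : ∀ m → (3 + m) * ((3 + m) * 1) + (4 + m) * ((4 + m) * ((4 + m) * 1)) ≡
    (4 + m) * ((4 + m) * 1) + (3 * (2 + m) * (2 + m) + 7 * (2 + m) + 4) + (3 + m) * ((3 + m) * ((3 + m) * 1))
  difference = solve-∀
  regroup : ∀ m w b → (4 + m) * ((4 + m) * 1) + 2 * b + ((3 + m) * ((3 + m) * 1) + 2 * (w + 1)) ≡
    (3 + m) * ((3 + m) * 1) + ((4 + m) * ((4 + m) * 1) + 2 * (w + b + 1))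
  regroup = solve-∀

wordLength-ℓ : ∀ m → wordLength m ≡ ℓ (3 + m) ∸ 1
wordLength-ℓ m = sym (begin
  ((3 + m) ^ 3 ∸ (3 + m) ^ 2) / 2 ∸ 1                         ≡⟨ cong (λ c → (c ∸ (3 + m) ^ 2) / 2 ∸ 1) (cube-identity m) ⟩
  ((3 + m) ^ 2 + 2 * (wordLength m + 1) ∸ (3 + m) ^ 2) / 2 ∸ 1 ≡⟨ cong (λ c → c / 2 ∸ 1) (m+n∸m≡n ((3 + m) ^ 2) _) ⟩
  (2 * (wordLength m + 1)) / 2 ∸ 1                             ≡⟨ cong (λ c → c / 2 ∸ 1) (*-comm 2 (wordLength m + 1)) ⟩
  ((wordLength m + 1) * 2) / 2 ∸ 1                             ≡⟨ cong (_∸ 1) (m*n/n≡m (wordLength m + 1) 2) ⟩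
  wordLength m + 1 ∸ 1                                         ≡⟨ m+n∸n≡m (wordLength m) 1 ⟩
  wordLength m                                                 ∎)
  where open ≡-Reasoning

-- The word for k = 3 + m colours, whose last vertex 0 sees the colour 1 on
-- both (real and virtual) sides, is an NL-colouring of P_{ℓ(k)-1}.
lemma15 : (k : ℕ) → 4 ≤ k →
    ∃ λ (c : Fin (ℓ k ∸ 1) → Fin k) → IsNLColoring (Path (ℓ k ∸ 1)) k c
lemma15 1 (s≤s ())
lemma15 2 (s≤s (s≤s ()))
lemma15 (suc (suc (suc m))) _ =
  subst (λ n → ∃ λ (c : Fin n → Fin k) → IsNLColoring (Path n) k c) (trans length-word (wordLength-ℓ m))
    (Locating.nl-colouring k (decode N) (decode-swap N) (word m) 1 1 (proj₁ (word-end m)) 0 refl (proj₂ (word-end m))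
      (decodes-cast refl (sym length-word) decodes) (colours-occur m))
  where
  k N : ℕ
  k = 3 + m
  N = wordLength m ∸ 1
  open Verification N k
  decodes : Decodes 0 (wordLength m) (descriptors 1 (word m) 1)
  decodes = word-decodes m 1 ≤-refl refl (s≤s z≤n , (λ ()) , (λ ()))
  length-word : length (word m) ≡ wordLength m
  length-word = trans (sym (length-descriptors 1 (word m) 1)) (decodes-length _ decodes)
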